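{- Let $G$ be a finite simple graph and consider either the reversible $r$-bootstrap percolation process (for some positive integer $r$) or the majority process on $G$, started from an initial configuration $\omega^{(0)}$. Suppose every vertex that is active in $\omega^{(0)}$ is stable in $\omega^{(0)}$. Then for every $t\ge 0$, every vertex that is active in $\omega^{(t)}$ is stable in $\omega^{(t)}$.
   Context: A configuration on $G=(V,E)$ is a vector $\omega\in\{0,1\}^V$; vertex $v$ is active if $\omega_v=1$ and inactive otherwise. Given an updating rule $f$, the process is $\omega^{(t)}=f(\omega^{(t-1)})$, $t\ge1$. Reversible $r$-bootstrap percolation: $\omega^{(t)}_v=1$ if $v$ has at least $r$ active neighbors in $\omega^{(t-1)}$, and $\omega^{(t)}_v=0$ otherwise. Majority process: $\omega^{(t)}_v=1$ if $\sum_{u\in N(v)}\omega^{(t-1)}_u+\omega^{(t-1)}_v/2>\deg(v)/2$, and $0$ otherwise (i.e. each vertex takes the majority state of its neighbors, keeping its state in case of a tie). A vertex active in $\omega^{(t')}$ is called stable in $\omega^{(t')}$ if it is active in $\omega^{(t)}$ for all $t\ge t'$. -}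

module Defs where

open import Data.Nat using (ℕ; zero; suc; _+_; _*_; _≤_; _<_; _≤ᵇ_; _<ᵇ_)
open import Data.Bool using (Bool; true; false; _∧_; if_then_else_)
open import Data.Fin using (Fin; zero; suc)
open import Relation.Binary.PropositionalEquality using (_≡_)

record Graph : Set where
  field
    n     : ℕ
    adj   : Fin n → Fin n → Bool
    sym   : ∀ u v → adj u v ≡ adj v u
    irref : ∀ v → adj v v ≡ false
open Graph public

Config : Graph → Set
Config G = Fin (n G) → Bool

count : ∀ {m} → (Fin m → Bool) → ℕ
count {zero}  p = 0
count {suc m} p = (if p zero then 1 else 0) + count (λ i → p (suc i))

deg : (G : Graph) → Fin (n G) → ℕ
deg G v = count (λ u → adj G v u)

activeNbrs : (G : Graph) → Config G → Fin (n G) → ℕ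
activeNbrs G ω v = count (λ u → adj G v u ∧ ω u)

bit : Bool → ℕ
bit true  = 1
bit false = 0

data Rule : Set where
  reversibleBootstrap : (r : ℕ) → 1 ≤ r → Rule
  majority            : Rule

-- ω'_v = 1 iff r ≤ #active neighbours
-- majority: ω'_v = 1 iff Σ ω_u + ω_v/2 > deg/2, i.e. 2 Σ ω_u + ω_v > deg
step : Rule → (G : Graph) → Config G → Config G
step (reversibleBootstrap r _) G ω v = r ≤ᵇ activeNbrs G ω v
step majority G ω v = deg G v <ᵇ 2 * activeNbrs G ω v + bit (ω v)

config : Rule → (G : Graph) → Config G → ℕ → Config G
config ρ G ω zero    = ω
config ρ G ω (suc t) = step ρ G (config ρ G ω t)

Stable : Rule → (G : Graph) → Config G → ℕ → Fin (n G) → Set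
Stable ρ G ω t' v = config ρ G ω t' v ≡ true × (∀ t → t' ≤ t → config ρ G ω t v ≡ true)
  where open import Data.Product using (_×_)

-- Every update rule here is monotone: enlarging the set of active vertices can only enlarge
-- the set of active vertices one step later. If every initially active vertex is stable, then
-- ω⁽⁰⁾ ⊆ ω⁽ᵏ⁾ for all k, and applying the monotone step s times gives ω⁽ˢ⁾ ⊆ ω⁽ˢ⁺ᵏ⁾.
module Submission where

open import Defs
open import Data.Nat using (ℕ; zero; suc; _+_; _≤_; _∸_; z≤n; s≤s)
open import Data.Nat.Properties
  using (≤-refl; ≤-trans; <-≤-trans; m≤n⇒m≤1+n; +-mono-≤; *-monoʳ-≤; ≤ᵇ⇒≤; ≤⇒≤ᵇ; <ᵇ⇒<; <⇒<ᵇ; m+[n∸m]≡n)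
open import Data.Bool using (Bool; true; false; T; _∧_)
open import Data.Bool.Properties using (T-≡)
open import Data.Fin using (Fin; zero; suc)
open import Data.Product using (_,_; proj₂)
open import Function.Bundles using (Equivalence)
open import Level using (0ℓ)
open import Relation.Binary.PropositionalEquality using (_≡_; refl; subst)
open import Relation.Unary using (Pred; _⊆_)

Active : ∀ {m} → (Fin m → Bool) → Pred (Fin m) 0ℓ
Active p i = p i ≡ true

count-mono : ∀ {m} {p q : Fin m → Bool} → Active p ⊆ Active q → count p ≤ count q
count-mono {zero} p⊆q = z≤n
count-mono {suc m} {p} {q} p⊆q with p zero in p₀ | q zero in q₀
... | true  | true  = s≤s (count-mono {m} {λ i → p (suc i)} {λ i → q (suc i)} p⊆q)
... | true  | false with () ← subst (_≡ true) q₀ (p⊆q p₀)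
... | false | true  = m≤n⇒m≤1+n (count-mono {m} {λ i → p (suc i)} {λ i → q (suc i)} p⊆q)
... | false | false = count-mono {m} {λ i → p (suc i)} {λ i → q (suc i)} p⊆q

toT : ∀ {b} → b ≡ true → T b
toT = Equivalence.from T-≡

fromT : ∀ {b} → T b → b ≡ true
fromT = Equivalence.to T-≡

∧-monoʳ : ∀ a {b c : Bool} → (b ≡ true → c ≡ true) → a ∧ b ≡ true → a ∧ c ≡ true
∧-monoʳ true b⇒c = b⇒c

bit-mono : ∀ {b c : Bool} → (b ≡ true → c ≡ true) → bit b ≤ bit c
bit-mono {false} b⇒c = z≤n
bit-mono {true}  b⇒c with refl ← b⇒c refl = ≤-refl

activeNbrs-mono : (G : Graph) {ω ω′ : Config G} → Active ω ⊆ Active ω′ →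
                  ∀ v → activeNbrs G ω v ≤ activeNbrs G ω′ v
activeNbrs-mono G ω⊆ω′ v = count-mono (λ {u} → ∧-monoʳ (adj G v u) ω⊆ω′)

step-mono : ∀ ρ (G : Graph) {ω ω′ : Config G} →
            Active ω ⊆ Active ω′ → Active (step ρ G ω) ⊆ Active (step ρ G ω′)
step-mono (reversibleBootstrap r _) G ω⊆ω′ {v} active =
  fromT (≤⇒≤ᵇ (≤-trans (≤ᵇ⇒≤ r _ (toT active)) (activeNbrs-mono G ω⊆ω′ v)))
step-mono majority G ω⊆ω′ {v} active =
  fromT (<⇒<ᵇ (<-≤-trans (<ᵇ⇒< _ _ (toT active))
    (+-mono-≤ (*-monoʳ-≤ 2 (activeNbrs-mono G ω⊆ω′ v)) (bit-mono ω⊆ω′))))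

config-⊆-shift : ∀ ρ (G : Graph) (ω₀ : Config G) →
                 (∀ k → Active ω₀ ⊆ Active (config ρ G ω₀ k)) →
                 ∀ s k → Active (config ρ G ω₀ s) ⊆ Active (config ρ G ω₀ (s + k))
config-⊆-shift ρ G ω₀ ω₀⊆ zero    k = ω₀⊆ k
config-⊆-shift ρ G ω₀ ω₀⊆ (suc s) k = step-mono ρ G (config-⊆-shift ρ G ω₀ ω₀⊆ s k)

lemma1 : (ρ : Rule) (G : Graph) (ω₀ : Config G) →
         (∀ v → ω₀ v ≡ true → Stable ρ G ω₀ 0 v) →
         ∀ (t : ℕ) (v : Fin (n G)) → config ρ G ω₀ t v ≡ true → Stable ρ G ω₀ t v
lemma1 ρ G ω₀ stable₀ t v active = active , stays-active
  where
  ω₀⊆ : ∀ k → Active ω₀ ⊆ Active (config ρ G ω₀ k)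
  ω₀⊆ k {u} u-active = proj₂ (stable₀ u u-active) k z≤n

  stays-active : ∀ t′ → t ≤ t′ → config ρ G ω₀ t′ v ≡ true
  stays-active t′ t≤t′ = subst (λ s → Active (config ρ G ω₀ s) v) (m+[n∸m]≡n t≤t′)
    (config-⊆-shift ρ G ω₀ ω₀⊆ t (t′ ∸ t) active)
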